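{- Let $c$ be a positive integer and let $G=(V,E)$ be a graph on $n$ vertices such that at least $3n/4$ of its vertices have degree at least $4c$. Then the number of $c$-edge-connected components of $G$ is at most $5n/6$.
   Context: Graphs are undirected, may have parallel edges but no self-loops. A graph is $c$-edge-connected if it has no cut with fewer than $c$ edges (a single vertex is $c$-edge-connected). The $c$-edge-connected components of $G$ are the maximal induced $c$-edge-connected subgraphs of $G$; their vertex sets partition $V$. -}

module Defs where

open import Data.Nat using (ℕ; zero; suc; _≤_)
open import Data.Bool using (Bool; true; false; _∧_; _xor_; _∨_)
open import Data.Fin using (Fin)
open import Data.Fin.Properties using (_≟_)
open import Data.Fin.Subset using (Subset; _∈_; _∉_; _⊆_; Nonempty)
open import Data.Vec using (lookup)
open import Data.List using (List; []; _∷_; allFin)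
open import Data.List.Relation.Unary.All using (All)
open import Data.Product using (_×_; _,_; proj₁; proj₂; ∃)
open import Relation.Nullary.Decidable using (⌊_⌋)
open import Relation.Binary.PropositionalEquality using (_≡_; _≢_)

-- A multigraph on vertex set Fin n: a list of edges (parallel edges allowed),
-- each edge an unordered pair stored as an ordered pair of distinct vertices.
record Graph (n : ℕ) : Set where
  field
    edges    : List (Fin n × Fin n)
    loopless : All (λ e → proj₁ e ≢ proj₂ e) edges
open Graph public

count : ∀ {A : Set} → (A → Bool) → List A → ℕ
count p [] = zero
count p (x ∷ xs) with p x
... | true  = suc (count p xs)
... | false = count p xs

-- degree of v: number of edges incident to v (no loops, so each counted once)
degree : ∀ {n} → Graph n → Fin n → ℕ
degree G v = count (λ e → ⌊ v ≟ proj₁ e ⌋ ∨ ⌊ v ≟ proj₂ e ⌋) (edges G)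

#degAtLeast : ∀ {n} → Graph n → ℕ → ℕ
#degAtLeast G d = count (λ v → ⌊ d Data.Nat.≤? degree G v ⌋) (allFin _)
  where import Data.Nat

cutSize : ∀ {n} → Graph n → Subset n → Subset n → ℕ
cutSize G S T = count
  (λ e → (lookup S (proj₁ e) ∧ lookup S (proj₂ e))
         ∧ (lookup T (proj₁ e) xor lookup T (proj₂ e)))
  (edges G)

EdgeConnected : ∀ {n} → ℕ → Graph n → Subset n → Set
EdgeConnected c G S =
  ∀ T → T ⊆ S → Nonempty T → (∃ λ v → v ∈ S × v ∉ T) → c ≤ cutSize G S T

IsComponent : ∀ {n} → ℕ → Graph n → Subset n → Set
IsComponent c G S =
  Nonempty S × EdgeConnected c G S
  × (∀ S′ → S ⊆ S′ → EdgeConnected c G S′ → S′ ≡ S)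

module Submission where

-- Start from the partition of V into one part and, as long as some part S has a cut of
-- fewer than c edges inside G[S], split S along it. Each split adds one part and fewer
-- than c crossing edges, so the final partition has k parts, each c-edge-connected, and at
-- most c(k - 1) edges between parts. The union of two c-edge-connected sets sharing a vertex
-- is c-edge-connected, so each component contains the part of each of its vertices;
-- distinct components therefore receive distinct parts and there are at most k of them.
-- Parts of size at least 2 give 2k ≤ n + s, where s counts singleton parts. A singleton of
-- degree ≥ 4c has all its edges between parts, so by double counting 4c·h ≤ 2c(k - 1) for the
-- h singletons of high degree, i.e. h < k/2; the others have low degree, so there are at
-- most n/4 of them. Hence 2k ≤ n + k/2 + n/4, that is 6k ≤ 5n.

open import Defs
open import Algebra.Properties.CommutativeSemigroup using (interchange)
open import Data.Bool using (Bool; true; false; _∧_; _∨_; _xor_; not; if_then_else_)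
open import Data.Bool.Properties using (¬-not; T-≡)
open import Data.Fin using (Fin; zero; suc)
open import Data.Fin.Properties using (_≟_; any?; injective⇒≤)
import Data.Fin.Properties as Fin
open import Data.Fin.Subset using (Subset; _∈_; _∉_; _⊆_; _∩_; _∪_; Nonempty)
open import Data.Fin.Subset.Properties
  using (_∈?_; _⊆?_; nonempty?; anySubset?; p∩q⊆p; x∈p∩q⁺; x∈p∩q⁻; p⊆p∪q; q⊆p∪q; x∈p∪q⁻; ⊆-antisym)
open import Data.List using (List; []; _∷_; length)
import Data.List as List
open import Data.List.Membership.Propositional.Properties using (∈-lookup)
open import Data.List.Relation.Unary.All using (All; []; _∷_; universal)
import Data.List.Relation.Unary.All as All
open import Data.List.Relation.Unary.AllPairs using ([]; _∷_)
open import Data.List.Relation.Unary.Unique.Propositional using (Unique)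
open import Data.Nat using (ℕ; zero; suc; _+_; _*_; _≤_; _<_; _<?_; z≤n; s≤s)
import Data.Nat as ℕ
open import Data.Nat.Properties hiding (_≟_; suc-injective)
open import Data.Nat.Tactic.RingSolver using (solve-∀)
open import Data.Product using (Σ; _×_; _,_; proj₁; proj₂; ∃; ∃₂)
open import Data.Sum using (_⊎_; inj₁; inj₂; [_,_]′)
open import Data.Unit using (tt)
open import Data.Vec using (lookup; tabulate)
open import Data.Vec.Properties using ([]=⇒lookup; lookup⇒[]=; lookup-zipWith; lookup∘tabulate)
open import Function using (_∘_; id; Equivalence)
open import Relation.Binary.PropositionalEquality
open import Relation.Nullary using (Dec; ¬_; contradiction)
open import Relation.Nullary.Decidable using (⌊_⌋; yes; no; _×-dec_; ¬?; ⌊⌋-map′; toWitness; fromWitness)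

open import Algebra.Properties.Semiring.Sum +-*-semiring
  using (sum-syntax; ∑-distrib-+; ∑-comm; sum-cong-≗; *-distribʳ-sum)

𝟙 : Bool → ℕ
𝟙 true  = 1
𝟙 false = 0

𝟙-∨ : ∀ a b → 𝟙 (a ∨ b) ≤ 𝟙 a + 𝟙 b
𝟙-∨ true  b = s≤s z≤n
𝟙-∨ false b = ≤-refl

⌊⌋-true : ∀ {P : Set} (d : Dec P) → P → ⌊ d ⌋ ≡ true
⌊⌋-true d p = Equivalence.to T-≡ (fromWitness {a? = d} p)

⌊⌋-true⁻ : ∀ {P : Set} (d : Dec P) → ⌊ d ⌋ ≡ true → P
⌊⌋-true⁻ d eq = toWitness {a? = d} (Equivalence.from T-≡ eq)

module _ {A : Set} where

  count-∷ : ∀ (p : A → Bool) x xs → count p (x ∷ xs) ≡ 𝟙 (p x) + count p xs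
  count-∷ p x xs with p x
  ... | true  = refl
  ... | false = refl

  count-mono : ∀ {P : A → Set} {p q : A → Bool} {xs} → All P xs →
               (∀ {x} → P x → p x ≡ true → q x ≡ true) → count p xs ≤ count q xs
  count-mono []         _   = z≤n
  count-mono {p = p} {q} {x ∷ xs} (px ∷ pxs) p⇒q
    rewrite count-∷ p x xs | count-∷ q x xs = +-mono-≤ (𝟙-mono (p⇒q px)) (count-mono pxs p⇒q)
    where
    𝟙-mono : ∀ {a b} → (a ≡ true → b ≡ true) → 𝟙 a ≤ 𝟙 b
    𝟙-mono {false} _   = z≤n
    𝟙-mono {true}  a⇒b rewrite a⇒b refl = ≤-refl

  count-∨ : ∀ (p q : A → Bool) xs → count (λ x → p x ∨ q x) xs ≤ count p xs + count q xs
  count-∨ p q []       = z≤n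
  count-∨ p q (x ∷ xs)
    rewrite count-∷ (λ x → p x ∨ q x) x xs | count-∷ p x xs | count-∷ q x xs = begin
      𝟙 (p x ∨ q x) + count (λ x → p x ∨ q x) xs       ≤⟨ +-mono-≤ (𝟙-∨ (p x) (q x)) (count-∨ p q xs) ⟩
      (𝟙 (p x) + 𝟙 (q x)) + (count p xs + count q xs)
        ≡⟨ interchange +-commutativeSemigroup (𝟙 (p x)) (𝟙 (q x)) (count p xs) (count q xs) ⟩
      (𝟙 (p x) + count p xs) + (𝟙 (q x) + count q xs)  ∎
    where open ≤-Reasoning

  count-false : ∀ (xs : List A) → count (λ _ → false) xs ≡ 0
  count-false []       = refl
  count-false (_ ∷ xs) = count-false xs

  count-tabulate : ∀ {m} (p : A → Bool) (f : Fin m → A) → count p (List.tabulate f) ≡ ∑[ x < m ] 𝟙 (p (f x))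
  count-tabulate {zero}  p f = refl
  count-tabulate {suc m} p f =
    trans (count-∷ p (f zero) _) (cong (𝟙 (p (f zero)) +_) (count-tabulate p (f ∘ suc)))

∑-cong : ∀ {n} {f g : Fin n → ℕ} → (∀ i → f i ≡ g i) → ∑[ i < n ] f i ≡ ∑[ i < n ] g i
∑-cong = sum-cong-≗

∑-+ : ∀ {n} {f g : Fin n → ℕ} → ∑[ i < n ] (f i + g i) ≡ ∑[ i < n ] f i + ∑[ i < n ] g i
∑-+ {f = f} {g} = ∑-distrib-+ f g

∑-mono-≤ : ∀ {n} {f g : Fin n → ℕ} → (∀ i → f i ≤ g i) → ∑[ i < n ] f i ≤ ∑[ i < n ] g i
∑-mono-≤ {zero}  f≤g = z≤n
∑-mono-≤ {suc n} f≤g = +-mono-≤ (f≤g zero) (∑-mono-≤ (f≤g ∘ suc))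

∑-const : ∀ n m → ∑[ i < n ] m ≡ n * m
∑-const zero    m = refl
∑-const (suc n) m = cong (m +_) (∑-const n m)

∑-zero : ∀ n → ∑[ i < n ] 0 ≡ 0
∑-zero n = trans (∑-const n 0) (*-zeroʳ n)

term≤∑ : ∀ {n} (f : Fin n → ℕ) i → f i ≤ ∑[ j < n ] f j
term≤∑ f zero    = m≤m+n _ _
term≤∑ f (suc i) = ≤-trans (term≤∑ (f ∘ suc) i) (m≤n+m _ _)

∑-δ : ∀ {n} (i : Fin n) (g : Fin n → ℕ) → ∑[ j < n ] (𝟙 ⌊ j ≟ i ⌋ * g j) ≡ g i
∑-δ {suc n} zero    g = trans (cong₂ _+_ (*-identityˡ (g zero)) (∑-zero n)) (+-identityʳ (g zero))
∑-δ {suc n} (suc i) g =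
  trans (∑-cong λ j → cong (λ b → 𝟙 b * g (suc j)) (⌊⌋-map′ (cong suc) Fin.suc-injective (j ≟ i)))
        (∑-δ i (g ∘ suc))

∑-δ₁ : ∀ {n} (i : Fin n) → ∑[ j < n ] 𝟙 ⌊ j ≟ i ⌋ ≡ 1
∑-δ₁ i = trans (∑-cong λ j → sym (*-identityʳ (𝟙 ⌊ j ≟ i ⌋))) (∑-δ i (λ _ → 1))

∑-𝟙-split : ∀ {n} (p q : Fin n → Bool) →
            ∑[ x < n ] 𝟙 (p x) ≤ ∑[ x < n ] 𝟙 (p x ∧ q x) + ∑[ x < n ] 𝟙 (not (q x))
∑-𝟙-split {n} p q = ≤-trans (∑-mono-≤ (λ x → split (p x) (q x))) (≤-reflexive (∑-+ {n}))
  where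
  split : ∀ a b → 𝟙 a ≤ 𝟙 (a ∧ b) + 𝟙 (not b)
  split true  true  = ≤-refl
  split true  false = ≤-refl
  split false _     = z≤n

fibre-size : ∀ {n k} → (Fin n → Fin k) → Fin k → ℕ
fibre-size {n} ℓ j = ∑[ x < n ] 𝟙 ⌊ j ≟ ℓ x ⌋

∑-fibres : ∀ {n k} (ℓ : Fin n → Fin k) (g : Fin k → ℕ) →
           ∑[ x < n ] g (ℓ x) ≡ ∑[ j < k ] (fibre-size ℓ j * g j)
∑-fibres {n} {k} ℓ g = begin
  ∑[ x < n ] g (ℓ x)                          ≡⟨ ∑-cong (λ x → ∑-δ (ℓ x) g) ⟨
  ∑[ x < n ] ∑[ j < k ] (𝟙 ⌊ j ≟ ℓ x ⌋ * g j) ≡⟨ ∑-comm (λ x j → 𝟙 ⌊ j ≟ ℓ x ⌋ * g j) ⟩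
  ∑[ j < k ] ∑[ x < n ] (𝟙 ⌊ j ≟ ℓ x ⌋ * g j) ≡⟨ ∑-cong (λ j → *-distribʳ-sum (g j) (λ x → 𝟙 ⌊ j ≟ ℓ x ⌋)) ⟨
  ∑[ j < k ] (fibre-size ℓ j * g j)           ∎
  where open ≡-Reasoning

fibre-size-≥1 : ∀ {n k} (ℓ : Fin n → Fin k) {x j} → ℓ x ≡ j → 1 ≤ fibre-size ℓ j
fibre-size-≥1 ℓ {x} {j} ℓx≡j =
  subst (_≤ fibre-size ℓ j) (cong 𝟙 (⌊⌋-true (j ≟ ℓ x) (sym ℓx≡j))) (term≤∑ _ x)

fibre-size-≥2 : ∀ {n k} (ℓ : Fin n → Fin k) {a b j} → a ≢ b → ℓ a ≡ j → ℓ b ≡ j → 2 ≤ fibre-size ℓ j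
fibre-size-≥2 {n} ℓ {a} {b} {j} a≢b ℓa≡j ℓb≡j = begin
  2                                               ≡⟨ cong₂ _+_ (∑-δ₁ a) (∑-δ₁ b) ⟨
  ∑[ x < n ] 𝟙 ⌊ x ≟ a ⌋ + ∑[ x < n ] 𝟙 ⌊ x ≟ b ⌋ ≡⟨ ∑-+ {n} ⟨
  ∑[ x < n ] (𝟙 ⌊ x ≟ a ⌋ + 𝟙 ⌊ x ≟ b ⌋)          ≤⟨ ∑-mono-≤ pointwise ⟩
  fibre-size ℓ j                                  ∎
  where
  open ≤-Reasoning
  pointwise : ∀ x → 𝟙 ⌊ x ≟ a ⌋ + 𝟙 ⌊ x ≟ b ⌋ ≤ 𝟙 ⌊ j ≟ ℓ x ⌋
  pointwise x with x ≟ a | x ≟ b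
  ... | yes refl | yes refl = contradiction refl a≢b
  ... | yes refl | no  _    = ≤-reflexive (cong 𝟙 (sym (⌊⌋-true (j ≟ ℓ x) (sym ℓa≡j))))
  ... | no  _    | yes refl = ≤-reflexive (cong 𝟙 (sym (⌊⌋-true (j ≟ ℓ x) (sym ℓb≡j))))
  ... | no  _    | no  _    = z≤n

lookup-injective : ∀ {A : Set} {xs : List A} → Unique xs →
                   ∀ {i j} → List.lookup xs i ≡ List.lookup xs j → i ≡ j
lookup-injective (_    ∷ _) {zero}  {zero}  _  = refl
lookup-injective (x∉xs ∷ _) {zero}  {suc j} eq = contradiction eq (All.lookup x∉xs (∈-lookup j))
lookup-injective (x∉xs ∷ _) {suc i} {zero}  eq = contradiction (sym eq) (All.lookup x∉xs (∈-lookup i))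
lookup-injective (_    ∷ u) {suc i} {suc j} eq = cong suc (lookup-injective u eq)

6k≤5n : ∀ {k n i h l} → 2 * k ≤ n + i → i ≤ h + l → 2 * h ≤ k → 4 * l ≤ n → 6 * k ≤ 5 * n
6k≤5n {k} {n} {i} {h} {l} 2k≤n+i i≤h+l 2h≤k 4l≤n = begin
  6 * k                ≡⟨ *-assoc 2 3 k ⟩
  2 * (3 * k)          ≤⟨ *-monoʳ-≤ 2 3k≤2n+2l ⟩
  2 * (2 * n + 2 * l)  ≡⟨ double n l ⟩
  4 * n + 4 * l        ≤⟨ +-monoʳ-≤ (4 * n) 4l≤n ⟩
  4 * n + n            ≡⟨ +-comm (4 * n) n ⟩
  5 * n                ∎
  where
  open ≤-Reasoning
  double : ∀ n l → 2 * (2 * n + 2 * l) ≡ 4 * n + 4 * l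
  double = solve-∀
  regroup : ∀ n h l → 2 * (n + (h + l)) ≡ 2 * n + 2 * l + 2 * h
  regroup = solve-∀
  3k≤2n+2l : 3 * k ≤ 2 * n + 2 * l
  3k≤2n+2l = +-cancelʳ-≤ k _ _ (begin
    3 * k + k              ≡⟨ +-comm (3 * k) k ⟩
    4 * k                  ≡⟨ *-assoc 2 2 k ⟩
    2 * (2 * k)            ≤⟨ *-monoʳ-≤ 2 (≤-trans 2k≤n+i (+-monoʳ-≤ n i≤h+l)) ⟩
    2 * (n + (h + l))      ≡⟨ regroup n h l ⟩
    2 * n + 2 * l + 2 * h  ≤⟨ +-monoʳ-≤ (2 * n + 2 * l) 2h≤k ⟩
    2 * n + 2 * l + k      ∎)

lookup-⊆ : ∀ {n} {p q : Subset n} {x} → p ⊆ q → lookup p x ≡ true → lookup q x ≡ true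
lookup-⊆ p⊆q = []=⇒lookup ∘ p⊆q ∘ lookup⇒[]= _ _

lookup-∉ : ∀ {n} {p : Subset n} {x} → x ∉ p → lookup p x ≡ false
lookup-∉ x∉p = ¬-not (x∉p ∘ lookup⇒[]= _ _)

class : ∀ {n k} → (Fin n → Fin k) → Fin k → Subset n
class ℓ j = tabulate (λ x → ⌊ ℓ x ≟ j ⌋)

∈-class⁺ : ∀ {n k} {ℓ : Fin n → Fin k} {j x} → ℓ x ≡ j → x ∈ class ℓ j
∈-class⁺ {ℓ = ℓ} {j} {x} ℓx≡j = lookup⇒[]= x _ (trans (lookup∘tabulate _ x) (⌊⌋-true (ℓ x ≟ j) ℓx≡j))

∈-class⁻ : ∀ {n k} {ℓ : Fin n → Fin k} {j x} → x ∈ class ℓ j → ℓ x ≡ j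
∈-class⁻ {ℓ = ℓ} {j} {x} x∈ = ⌊⌋-true⁻ (ℓ x ≟ j) (trans (sym (lookup∘tabulate _ x)) ([]=⇒lookup x∈))

split-label : ∀ {n k} → (Fin n → Fin k) → Subset n → Fin n → Fin (suc k)
split-label ℓ T x = if lookup T x then zero else suc (ℓ x)

split-label-∈ : ∀ {n k} (ℓ : Fin n → Fin k) {T x} → x ∈ T → split-label ℓ T x ≡ zero
split-label-∈ ℓ x∈T rewrite []=⇒lookup x∈T = refl

split-label-∉ : ∀ {n k} (ℓ : Fin n → Fin k) {T x} → x ∉ T → split-label ℓ T x ≡ suc (ℓ x)
split-label-∉ ℓ x∉T rewrite lookup-∉ x∉T = refl

split-label-surjective : ∀ {n k} {ℓ : Fin n → Fin k} {j T t y} → T ⊆ class ℓ j →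
                         t ∈ T → y ∈ class ℓ j → y ∉ T →
                         (∀ i → ∃ λ x → ℓ x ≡ i) → ∀ i → ∃ λ x → split-label ℓ T x ≡ i
split-label-surjective {ℓ = ℓ} T⊆C t∈T y∈C y∉T surj zero = _ , split-label-∈ ℓ t∈T
split-label-surjective {ℓ = ℓ} {T = T} T⊆C t∈T y∈C y∉T surj (suc i) with surj i
... | x , refl with x ∈? T
...   | no  x∉T = x , split-label-∉ ℓ x∉T
...   | yes x∈T =
  _ , trans (split-label-∉ ℓ y∉T) (cong suc (trans (∈-class⁻ y∈C) (sym (∈-class⁻ (T⊆C x∈T)))))

module _ {n : ℕ} (c : ℕ) (G : Graph n) where

  cutSize-restrict : ∀ {A S : Subset n} T → A ⊆ S → cutSize G A (A ∩ T) ≤ cutSize G S T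
  cutSize-restrict {A} {S} T A⊆S = count-mono (universal (λ _ → tt) (edges G)) λ {(a , b)} _ →
    restrict-bits (lookup-⊆ A⊆S) (lookup-⊆ A⊆S) ∘
    subst (λ z → (lookup A a ∧ lookup A b) ∧ z ≡ true)
          (cong₂ _xor_ (lookup-zipWith _∧_ a A T) (lookup-zipWith _∧_ b A T))
    where
    restrict-bits : ∀ {a b s t u v} → (a ≡ true → s ≡ true) → (b ≡ true → t ≡ true) →
                    (a ∧ b) ∧ ((a ∧ u) xor (b ∧ v)) ≡ true → (s ∧ t) ∧ (u xor v) ≡ true
    restrict-bits {true}  {true}  a⇒s b⇒t h rewrite a⇒s refl | b⇒t refl = h
    restrict-bits {true}  {false} _   _   ()
    restrict-bits {false}         _   _   ()

  EdgeConnected-split⇒c≤cutSize : ∀ {A S T : Subset n} {x y} → EdgeConnected c G A → A ⊆ S →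
                                  x ∈ A → x ∈ T → y ∈ A → y ∉ T → c ≤ cutSize G S T
  EdgeConnected-split⇒c≤cutSize {A} {S} {T} ecA A⊆S x∈A x∈T y∈A y∉T = ≤-trans
    (ecA (A ∩ T) (p∩q⊆p A T) (_ , x∈p∩q⁺ (x∈A , x∈T)) (_ , y∈A , y∉T ∘ proj₂ ∘ x∈p∩q⁻ A T))
    (cutSize-restrict T A⊆S)

  -- A cut of A ∪ B also cuts A or B: the common vertex w is on one side,
  -- and some vertex of A or of B is on the other.
  ∪-EdgeConnected : ∀ {A B : Subset n} {w} → EdgeConnected c G A → EdgeConnected c G B →
                    w ∈ A → w ∈ B → EdgeConnected c G (A ∪ B)
  ∪-EdgeConnected {A} {B} ecA ecB w∈A w∈B T T⊆A∪B (u , u∈T) (v , v∈A∪B , v∉T) with _ ∈? T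
  ... | yes w∈T = [ (λ v∈A → EdgeConnected-split⇒c≤cutSize ecA (p⊆p∪q B) w∈A w∈T v∈A v∉T)
                  , (λ v∈B → EdgeConnected-split⇒c≤cutSize ecB (q⊆p∪q A B) w∈B w∈T v∈B v∉T)
                  ]′ (x∈p∪q⁻ A B v∈A∪B)
  ... | no  w∉T = [ (λ u∈A → EdgeConnected-split⇒c≤cutSize ecA (p⊆p∪q B) u∈A u∈T w∈A w∉T)
                  , (λ u∈B → EdgeConnected-split⇒c≤cutSize ecB (q⊆p∪q A B) u∈B u∈T w∈B w∉T)
                  ]′ (x∈p∪q⁻ A B (T⊆A∪B u∈T))

  component-absorbs : ∀ {C B : Subset n} {v} → IsComponent c G C → EdgeConnected c G B →
                      v ∈ C → v ∈ B → B ⊆ C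
  component-absorbs {C} {B} (_ , ecC , maximal) ecB v∈C v∈B =
    subst (B ⊆_) (maximal (C ∪ B) (p⊆p∪q B) (∪-EdgeConnected ecC ecB v∈C v∈B)) (q⊆p∪q C B)

  components-meeting-≡ : ∀ {C C′ B : Subset n} {x y} → IsComponent c G C → IsComponent c G C′ →
                         EdgeConnected c G B → x ∈ C → x ∈ B → y ∈ C′ → y ∈ B → C ≡ C′
  components-meeting-≡ isC isC′ ecB x∈C x∈B y∈C′ y∈B = ⊆-antisym
    (component-absorbs isC′ (proj₁ (proj₂ isC)) x∈C′ x∈C)
    (component-absorbs isC (proj₁ (proj₂ isC′)) x∈C x∈C′)
    where x∈C′ = component-absorbs isC′ ecB y∈C′ y∈B x∈B

  SmallCut : Subset n → Subset n → Set
  SmallCut S T = T ⊆ S × Nonempty T × (∃ λ v → v ∈ S × v ∉ T) × cutSize G S T < c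

  smallCut? : ∀ S → Dec (∃ (SmallCut S))
  smallCut? S = anySubset? λ T →
    T ⊆? S ×-dec nonempty? T ×-dec any? (λ v → v ∈? S ×-dec ¬? (v ∈? T)) ×-dec cutSize G S T <? c

  noSmallCut⇒EdgeConnected : ∀ {S} → ¬ ∃ (SmallCut S) → EdgeConnected c G S
  noSmallCut⇒EdgeConnected ∄cut T T⊆S ne out = ≮⇒≥ λ small → ∄cut (T , T⊆S , ne , out , small)

  crossing : ∀ {k} → (Fin n → Fin k) → ℕ
  crossing ℓ = count (λ e → not ⌊ ℓ (proj₁ e) ≟ ℓ (proj₂ e) ⌋) (edges G)

  crossing-split-label : ∀ {k} (ℓ : Fin n → Fin k) {j T} → T ⊆ class ℓ j →
                         crossing (split-label ℓ T) ≤ crossing ℓ + cutSize G (class ℓ j) T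
  crossing-split-label ℓ {j} {T} T⊆C = ≤-trans
    (count-mono (universal (λ _ → tt) (edges G)) λ {(a , b)} _ → separated a b)
    (count-∨ _ crosses (edges G))
    where
    C = class ℓ j
    ℓ′ = split-label ℓ T

    crosses : Fin n × Fin n → Bool
    crosses e = (lookup C (proj₁ e) ∧ lookup C (proj₂ e)) ∧ (lookup T (proj₁ e) xor lookup T (proj₂ e))

    crossesʳ : ∀ {a b} → a ∈ C → b ∈ C → a ∈ T → b ∉ T → crosses (a , b) ≡ true
    crossesʳ a∈C b∈C a∈T b∉T
      rewrite []=⇒lookup a∈C | []=⇒lookup b∈C | []=⇒lookup a∈T | lookup-∉ b∉T = refl

    crossesˡ : ∀ {a b} → a ∈ C → b ∈ C → a ∉ T → b ∈ T → crosses (a , b) ≡ true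
    crossesˡ a∈C b∈C a∉T b∈T
      rewrite []=⇒lookup a∈C | []=⇒lookup b∈C | lookup-∉ a∉T | []=⇒lookup b∈T = refl

    crossing-or-crosses : ∀ {a b} → (ℓ a ≡ ℓ b → crosses (a , b) ≡ true) →
                          not ⌊ ℓ a ≟ ℓ b ⌋ ∨ crosses (a , b) ≡ true
    crossing-or-crosses {a} {b} same⇒crosses with ℓ a ≟ ℓ b
    ... | yes same = same⇒crosses same
    ... | no  _    = refl

    separated : ∀ a b → not ⌊ ℓ′ a ≟ ℓ′ b ⌋ ≡ true → not ⌊ ℓ a ≟ ℓ b ⌋ ∨ crosses (a , b) ≡ true
    separated a b with a ∈? T | b ∈? T
    ... | yes a∈T | yes b∈T rewrite split-label-∈ ℓ a∈T | split-label-∈ ℓ b∈T = λ ()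
    ... | yes a∈T | no  b∉T = λ _ → crossing-or-crosses λ same →
      crossesʳ (T⊆C a∈T) (∈-class⁺ (trans (sym same) (∈-class⁻ (T⊆C a∈T)))) a∈T b∉T
    ... | no  a∉T | yes b∈T = λ _ → crossing-or-crosses λ same →
      crossesˡ (∈-class⁺ (trans same (∈-class⁻ (T⊆C b∈T)))) (T⊆C b∈T) a∉T b∈T
    ... | no  a∉T | no  b∉T rewrite split-label-∉ ℓ a∉T | split-label-∉ ℓ b∉T
                                  | ⌊⌋-map′ (cong suc) Fin.suc-injective (ℓ a ≟ ℓ b) =
      λ h → subst (λ z → z ∨ crosses (a , b) ≡ true) (sym h) refl

  -- crossing-bound: at most c(k - 1) edges join different parts, stated without truncated subtraction.
  record Partition : Set where
    field
      k                : ℕ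
      label            : Fin n → Fin k
      label-surjective : ∀ j → ∃ λ x → label x ≡ j
      crossing-bound   : crossing label + c ≤ c * k

  Connected : Partition → Set
  Connected P = ∀ j → EdgeConnected c G (class (Partition.label P) j)

  parts≤vertices : (P : Partition) → Partition.k P ≤ n
  parts≤vertices P = injective⇒≤ {f = proj₁ ∘ label-surjective} λ {i} {j} eq →
    trans (sym (proj₂ (label-surjective i))) (trans (cong label eq) (proj₂ (label-surjective j)))
    where open Partition P

  trivial-partition : Fin n → Partition
  trivial-partition v = record
    { k                = 1
    ; label            = λ _ → zero
    ; label-surjective = λ { zero → v , refl }
    ; crossing-bound   = ≤-reflexive (trans (cong (_+ c) (count-false (edges G))) (sym (*-identityʳ c)))
    }

  split : (P : Partition) → ∀ {j T} → SmallCut (class (Partition.label P) j) T → Partition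
  split P {j} {T} (T⊆C , (_ , t∈T) , (_ , y∈C , y∉T) , small) = record
    { k                = suc k
    ; label            = split-label label T
    ; label-surjective = split-label-surjective T⊆C t∈T y∈C y∉T label-surjective
    ; crossing-bound   = begin
        crossing (split-label label T) + c  ≤⟨ +-monoˡ-≤ c (crossing-split-label label T⊆C) ⟩
        crossing label + cutSize G C T + c ≤⟨ +-monoˡ-≤ c (+-monoʳ-≤ (crossing label) (<⇒≤ small)) ⟩
        crossing label + c + c             ≤⟨ +-monoˡ-≤ c crossing-bound ⟩
        c * k + c                          ≡⟨ trans (*-suc c k) (+-comm c (c * k)) ⟨
        c * suc k                          ∎
    }
    where
    open Partition P
    open ≤-Reasoning
    C = class label j

  connected-or-smallCut : (P : Partition) →
                          Connected P ⊎ ∃₂ λ j T → SmallCut (class (Partition.label P) j) T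
  connected-or-smallCut P with any? (λ j → smallCut? (class (Partition.label P) j))
  ... | yes (j , T , cut) = inj₂ (j , T , cut)
  ... | no  ∄cut          = inj₁ λ j → noSmallCut⇒EdgeConnected (∄cut ∘ (j ,_))

  -- A partition has at most n parts, so n ≤ k + m guarantees that m further splits suffice.
  refine : ∀ m (P : Partition) → n ≤ Partition.k P + m → Σ Partition Connected
  refine m P n≤k+m with connected-or-smallCut P
  refine m       P n≤k+m | inj₁ connected = P , connected
  refine zero    P n≤k   | inj₂ (_ , _ , cut) =
    contradiction (subst (n ≤_) (+-identityʳ _) n≤k) (<⇒≱ (parts≤vertices (split P cut)))
  refine (suc m) P n≤k+m | inj₂ (_ , _ , cut) = refine m (split P cut) (subst (n ≤_) (+-suc _ m) n≤k+m)

  connected-partition : Fin n → Σ Partition Connected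
  connected-partition v = refine n (trivial-partition v) (n≤1+n n)

  components≤parts : (P : Partition) → Connected P → ∀ {comps} → Unique comps →
                     All (IsComponent c G) comps → length comps ≤ Partition.k P
  components≤parts P connected {comps} unique components = injective⇒≤ part-of-injective
    where
    open Partition P
    component : ∀ i → IsComponent c G (List.lookup comps i)
    component i = All.lookup components (∈-lookup i)
    part-of : Fin (length comps) → Fin k
    part-of i = label (proj₁ (proj₁ (component i)))
    part-of-injective : ∀ {i j} → part-of i ≡ part-of j → i ≡ j
    part-of-injective {i} {j} eq = lookup-injective unique
      (components-meeting-≡ (component i) (component j) (connected (part-of j))
        (proj₂ (proj₁ (component i))) (∈-class⁺ eq) (proj₂ (proj₁ (component j))) (∈-class⁺ refl))

  incident : Fin n → Fin n × Fin n → Bool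
  incident x e = ⌊ x ≟ proj₁ e ⌋ ∨ ⌊ x ≟ proj₂ e ⌋

  incident⁻ : ∀ {x a b} → incident x (a , b) ≡ true → x ≡ a ⊎ x ≡ b
  incident⁻ {x} {a} {b} inc with x ≟ a | x ≟ b
  ... | yes x≡a | _       = inj₁ x≡a
  ... | no  _   | yes x≡b = inj₂ x≡b
  ... | no  _   | no  _   = contradiction inc λ ()

  handshake≤ : ∀ (q : Fin n × Fin n → Bool) es →
               ∑[ x < n ] count (λ e → q e ∧ incident x e) es ≤ 2 * count q es
  handshake≤ q []       = ≤-reflexive (∑-zero n)
  handshake≤ q (e ∷ es) = begin
    ∑[ x < n ] count (λ d → q d ∧ incident x d) (e ∷ es)
      ≡⟨ ∑-cong (λ x → count-∷ (λ d → q d ∧ incident x d) e es) ⟩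
    ∑[ x < n ] (𝟙 (q e ∧ incident x e) + count (λ d → q d ∧ incident x d) es)
      ≡⟨ ∑-+ {n} ⟩
    ∑[ x < n ] 𝟙 (q e ∧ incident x e) + ∑[ x < n ] count (λ d → q d ∧ incident x d) es
      ≤⟨ +-mono-≤ (one-edge e) (handshake≤ q es) ⟩
    2 * 𝟙 (q e) + 2 * count q es
      ≡⟨ trans (cong (2 *_) (count-∷ q e es)) (*-distribˡ-+ 2 (𝟙 (q e)) (count q es)) ⟨
    2 * count q (e ∷ es)
      ∎
    where
    open ≤-Reasoning
    one-edge : ∀ e → ∑[ x < n ] 𝟙 (q e ∧ incident x e) ≤ 2 * 𝟙 (q e)
    one-edge e with q e
    ... | false = ≤-reflexive (∑-zero n)
    ... | true  = begin
      ∑[ x < n ] 𝟙 (incident x e)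
        ≤⟨ ∑-mono-≤ (λ x → 𝟙-∨ ⌊ x ≟ proj₁ e ⌋ ⌊ x ≟ proj₂ e ⌋) ⟩
      ∑[ x < n ] (𝟙 ⌊ x ≟ proj₁ e ⌋ + 𝟙 ⌊ x ≟ proj₂ e ⌋)
        ≡⟨ ∑-+ {n} ⟩
      ∑[ x < n ] 𝟙 ⌊ x ≟ proj₁ e ⌋ + ∑[ x < n ] 𝟙 ⌊ x ≟ proj₂ e ⌋
        ≡⟨ cong₂ _+_ (∑-δ₁ (proj₁ e)) (∑-δ₁ (proj₂ e)) ⟩
      2 ∎

  high : Fin n → Bool
  high x = ⌊ 4 * c ℕ.≤? degree G x ⌋

  four-low≤n : 3 * n ≤ 4 * #degAtLeast G (4 * c) → 4 * ∑[ x < n ] 𝟙 (not (high x)) ≤ n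
  four-low≤n many-high = +-cancelʳ-≤ (3 * n) _ _ (begin
    4 * low + 3 * n   ≤⟨ +-monoʳ-≤ (4 * low) many-high ⟩
    4 * low + 4 * hi  ≡⟨ *-distribˡ-+ 4 low hi ⟨
    4 * (low + hi)    ≡⟨ cong (4 *_) low+hi≡n ⟩
    n + 3 * n         ∎)
    where
    open ≤-Reasoning
    low = ∑[ x < n ] 𝟙 (not (high x))
    hi  = #degAtLeast G (4 * c)
    𝟙-not+𝟙 : ∀ b → 𝟙 (not b) + 𝟙 b ≡ 1
    𝟙-not+𝟙 true  = refl
    𝟙-not+𝟙 false = refl
    low+hi≡n : low + hi ≡ n
    low+hi≡n = begin-equality
      low + hi                                     ≡⟨ cong (low +_) (count-tabulate high id) ⟩
      low + ∑[ x < n ] 𝟙 (high x)                  ≡⟨ ∑-+ {n} ⟨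
      ∑[ x < n ] (𝟙 (not (high x)) + 𝟙 (high x))   ≡⟨ ∑-cong (λ x → 𝟙-not+𝟙 (high x)) ⟩
      ∑[ x < n ] 1                                 ≡⟨ trans (∑-const n 1) (*-identityʳ n) ⟩
      n                                            ∎

  module _ (P : Partition) where
    open Partition P

    isolated : Fin n → Bool
    isolated x = ⌊ fibre-size label (label x) ℕ.≟ 1 ⌋

    -- Each part contributes at least 2 to n + #isolated: its size if that is at least 2,
    -- and 1 + 1 if it is a singleton.
    twice-parts≤n+isolated : 2 * k ≤ n + ∑[ x < n ] 𝟙 (isolated x)
    twice-parts≤n+isolated = begin
      2 * k                                     ≡⟨ trans (∑-const k 2) (*-comm k 2) ⟨
      ∑[ j < k ] 2                              ≤⟨ ∑-mono-≤ (λ j → 2≤weight (size≥1 j)) ⟩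
      ∑[ j < k ] (fibre-size label j * weight j) ≡⟨ ∑-fibres label weight ⟨
      ∑[ x < n ] (1 + 𝟙 (isolated x))           ≡⟨ ∑-+ {n} ⟩
      ∑[ x < n ] 1 + isolated-count
                                                ≡⟨ cong (_+ isolated-count) (trans (∑-const n 1) (*-identityʳ n)) ⟩
      n + isolated-count                        ∎
      where
      open ≤-Reasoning
      isolated-count = ∑[ x < n ] 𝟙 (isolated x)
      weight : Fin k → ℕ
      weight j = 1 + 𝟙 ⌊ fibre-size label j ℕ.≟ 1 ⌋
      size≥1 : ∀ j → 1 ≤ fibre-size label j
      size≥1 j = fibre-size-≥1 label (proj₂ (label-surjective j))
      2≤weight : ∀ {s} → 1 ≤ s → 2 ≤ s * (1 + 𝟙 ⌊ s ℕ.≟ 1 ⌋)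
      2≤weight {1}           _ = ≤-refl
      2≤weight {suc (suc s)} _ = s≤s (s≤s z≤n)

    isolated-crossing : ∀ {x a b} → isolated x ≡ true → a ≢ b → incident x (a , b) ≡ true →
                        not ⌊ label a ≟ label b ⌋ ≡ true
    isolated-crossing {x} {a} {b} iso a≢b inc with label a ≟ label b
    ... | no  _    = refl
    ... | yes same = contradiction (subst (2 ≤_) size≡1 2≤size) λ { (s≤s ()) }
      where
      size≡1 : fibre-size label (label x) ≡ 1
      size≡1 = ⌊⌋-true⁻ (fibre-size label (label x) ℕ.≟ 1) iso
      ℓx≡ℓa : label x ≡ label a
      ℓx≡ℓa = [ cong label , (λ x≡b → trans (cong label x≡b) (sym same)) ]′ (incident⁻ inc)
      2≤size : 2 ≤ fibre-size label (label x)
      2≤size = fibre-size-≥2 label a≢b (sym ℓx≡ℓa) (trans (sym same) (sym ℓx≡ℓa))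

    -- The ≥ 4c edges at an isolated vertex of high degree all join different parts,
    -- and there are at most c(k - 1) such edges.
    twice-isolated-high≤parts : 1 ≤ c → 2 * ∑[ x < n ] 𝟙 (isolated x ∧ high x) ≤ k
    twice-isolated-high≤parts (s≤s z≤n) = *-cancelˡ-≤ 2 (*-cancelˡ-≤ c (begin
      c * (2 * (2 * h))                                ≡⟨ reassoc₁ c h ⟩
      h * (4 * c)                                      ≡⟨ *-distribʳ-sum (4 * c) (λ x → 𝟙 (isolated x ∧ high x)) ⟩
      ∑[ x < n ] (𝟙 (isolated x ∧ high x) * (4 * c))   ≤⟨ ∑-mono-≤ degree≤crossing-at ⟩
      ∑[ x < n ] crossing-at x                         ≤⟨ handshake≤ crosses (edges G) ⟩
      2 * crossing label                               ≤⟨ *-monoʳ-≤ 2 (≤-trans (m≤m+n _ c) crossing-bound) ⟩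
      2 * (c * k)                                      ≡⟨ reassoc₂ c k ⟩
      c * (2 * k)                                      ∎))
      where
      open ≤-Reasoning
      reassoc₁ : ∀ c h → c * (2 * (2 * h)) ≡ h * (4 * c)
      reassoc₁ = solve-∀
      reassoc₂ : ∀ c k → 2 * (c * k) ≡ c * (2 * k)
      reassoc₂ = solve-∀
      h = ∑[ x < n ] 𝟙 (isolated x ∧ high x)
      crosses : Fin n × Fin n → Bool
      crosses e = not ⌊ label (proj₁ e) ≟ label (proj₂ e) ⌋
      crossing-at : Fin n → ℕ
      crossing-at x = count (λ e → crosses e ∧ incident x e) (edges G)
      degree≤crossing-at : ∀ x → 𝟙 (isolated x ∧ high x) * (4 * c) ≤ crossing-at x
      degree≤crossing-at x with isolated x in iso | high x in hi
      ... | false | _     = z≤n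
      ... | true  | false = z≤n
      ... | true  | true  = begin
        4 * c + 0   ≡⟨ +-identityʳ (4 * c) ⟩
        4 * c       ≤⟨ ⌊⌋-true⁻ (4 * c ℕ.≤? degree G x) hi ⟩
        degree G x  ≤⟨ count-mono (loopless G) (λ {(a , b)} a≢b inc →
                         subst (λ z → z ∧ incident x (a , b) ≡ true)
                               (sym (isolated-crossing iso a≢b inc)) inc) ⟩
        crossing-at x ∎

  six-parts≤five-n : 1 ≤ c → 3 * n ≤ 4 * #degAtLeast G (4 * c) → (P : Partition) → 6 * Partition.k P ≤ 5 * n
  six-parts≤five-n 1≤c many-high P = 6k≤5n {i = isolated-count} {h = isolated-high-count} {l = low-count}
    (twice-parts≤n+isolated P) (∑-𝟙-split (isolated P) high)
    (twice-isolated-high≤parts P 1≤c) (four-low≤n many-high)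
    where
    isolated-count      = ∑[ x < n ] 𝟙 (isolated P x)
    isolated-high-count = ∑[ x < n ] 𝟙 (isolated P x ∧ high x)
    low-count           = ∑[ x < n ] 𝟙 (not (high x))

lemma3p3 : (c n : ℕ) → 1 ≤ c → (G : Graph n)
    → 3 * n ≤ 4 * #degAtLeast G (4 * c)
    → (comps : List (Subset n)) → Unique comps → All (IsComponent c G) comps
    → 6 * length comps ≤ 5 * n
lemma3p3 c zero    _   G _         []      _      _                    = z≤n
lemma3p3 c zero    _   G _         (_ ∷ _) _      (((() , _) , _) ∷ _)
lemma3p3 c (suc n) 1≤c G many-high comps   unique components =
  let P , connected = connected-partition c G zero in
  ≤-trans (*-monoʳ-≤ 6 (components≤parts c G P connected unique components))
          (six-parts≤five-n c G 1≤c many-high P)
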